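{- Let $A=(R,U,X)$, $B=(S,V,Y)$, $C=(T,W,Z)$ be concordance spaces. The canonical bijection $R\times(S\times T)\to(R\times S)\times T$, $(r,(s,t))\mapsto((r,s),t)$, viewed as a relation, is a morphism of concordance spaces from $A\otimes(B\wp C)$ to $(A\otimes B)\wp C$.
   Context: For $u,x\subseteq R$ write $u\perp x$ if $|u\cap x|\le1$; for $U\subseteq\mathcal{P}(R)$ let $U^{\circ}=\{x\subseteq R\mid u\perp x\ \forall u\in U\}$. A concordance space $(R,U,X)$ is a set with $U,X\subseteq\mathcal{P}(R)$, $U=X^{\circ}$, $X=U^{\circ}$. For $U\subseteq\mathcal{P}(R)$, $V\subseteq\mathcal{P}(S)$ let $U\otimes V=\{u\times v\mid u\in U,v\in V\}$. Define $(R,U,X)\otimes(S,V,Y)=(R\times S,((U\otimes V)^{\circ})^{\circ},(U\otimes V)^{\circ})$ and $(R,U,X)\wp(S,V,Y)=(R\times S,(X\otimes Y)^{\circ},((X\otimes Y)^{\circ})^{\circ})$. For a relation $F\subseteq R\times S$, $[u]F=\{s\mid\exists r\in u.\,rFs\}$ and $F[y]=\{r\mid\exists s\in y.\,rFs\}$; a morphism $(R,U,X)\to(S,V,Y)$ is a relation $F$ with $[u]F\in V$ for all $u\in U$ and $F[y]\in X$ for all $y\in Y$. -}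

module Defs where

open import Data.Product using (Σ; _×_; _,_; proj₁; proj₂)
open import Relation.Binary.PropositionalEquality using (_≡_)
open import Function.Bundles using (_⇔_)

Subset : Set → Set₁
Subset R = R → Set

Family : Set → Set₂
Family R = Subset R → Set₁

_⊥_ : {R : Set} → Subset R → Subset R → Set
_⊥_ {R} u x = (a b : R) → u a → x a → u b → x b → a ≡ b

_° : {R : Set} → Family R → Family R
(U °) x = ∀ u → U u → u ⊥ x

_≐_ : {R : Set} → Family R → Family R → Set₁
_≐_ {R} U V = (u : Subset R) → U u ⇔ V u

IsConcordance : {R : Set} → Family R → Family R → Set₁
IsConcordance U X = (U ≐ (X °)) × (X ≐ (U °))

_⊠_ : {R S : Set} → Subset R → Subset S → Subset (R × S)
(u ⊠ v) p = u (proj₁ p) × v (proj₂ p)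

-- U ⊗ V = { u × v | u ∈ U, v ∈ V }  (membership up to extensional equality of subsets)
_⊗_ : {R S : Set} → Family R → Family S → Family (R × S)
_⊗_ {R} {S} U V w =
  Σ (Subset R) λ u → Σ (Subset S) λ v →
    U u × V v × ((p : R × S) → w p ⇔ (u ⊠ v) p)

tensorU : {R S : Set} → Family R → Family S → Family (R × S)
tensorU U V = ((U ⊗ V) °) °

tensorX : {R S : Set} → Family R → Family S → Family (R × S)
tensorX U V = (U ⊗ V) °

parU : {R S : Set} → Family R → Family S → Family (R × S)
parU X Y = (X ⊗ Y) °

parX : {R S : Set} → Family R → Family S → Family (R × S)
parX X Y = ((X ⊗ Y) °) °

Rel : Set → Set → Set₁
Rel R S = R → S → Set

[_]_ : {R S : Set} → Subset R → Rel R S → Subset S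
([_]_ {R} u F) s = Σ R λ r → u r × F r s

_[_] : {R S : Set} → Rel R S → Subset S → Subset R
_[_] {R} {S} F y r = Σ S λ s → y s × F r s

IsMorphism : {R S : Set} → Family R → Family R → Family S → Family S → Rel R S → Set₁
IsMorphism U X V Y F =
  (∀ u → U u → V ([ u ] F)) × (∀ y → Y y → X (F [ y ]))

assoc : {R S T : Set} → R × (S × T) → (R × S) × T
assoc (r , (s , t)) = ((r , s) , t)

assocRel : {R S T : Set} → Rel (R × (S × T)) ((R × S) × T)
assocRel a b = assoc a ≡ b

-- The heart of the matter is that for u ∈ U, v ∈ (Y ⊗ Z)°, a ∈ (U ⊗ V)° and
-- z ∈ Z, the sets u × v and a × z, placed in the same space by the associator,
-- meet in at most one point. Given two common points (r,(s,t)) and (r',(s',t')),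
-- the pair {s, s'} is in V° = Y, because a meets each u × b (b ∈ V) in at most one
-- point; hence v ⊥ {s, s'} × z forces (s,t) = (s',t'). Then the singleton {s}
-- lies in Y° = V, and a ⊥ u × {s} forces r = r'. Both halves of the morphism
-- condition follow by transporting this orthogonality along the associator, a
-- bijection, between direct and inverse images. Only B has to be a concordance
-- space.
module Submission where

open import Defs
open import Data.Product using (_×_; _,_; proj₁; proj₂; assocʳ′)
open import Data.Sum using (inj₁; inj₂)
open import Function using (_∘_)
open import Function.Bundles using (Equivalence)
open import Function.Definitions using (Injective)
import Function.Properties.Equivalence as ⇔
open import Relation.Binary.PropositionalEquality using (_≡_; refl; sym; cong)
open import Relation.Unary using (_⊆_; _∪_; ｛_｝)

open Equivalence using (to; from)

private
  variable
    A B : Set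

⊥-sym : {u x : Subset A} → u ⊥ x → x ⊥ u
⊥-sym u⊥x a b xa ua xb ub = u⊥x a b ua xa ub xb

⊥-antitone : {u u′ x x′ : Subset A} → u′ ⊆ u → x′ ⊆ x → u ⊥ x → u′ ⊥ x′
⊥-antitone u′⊆u x′⊆x u⊥x a b ua xa ub xb = u⊥x a b (u′⊆u ua) (x′⊆x xa) (u′⊆u ub) (x′⊆x xb)

｛｝∈° : (U : Family A) (a : A) → (U °) ｛ a ｝
｛｝∈° U a u _ b c _ refl _ refl = refl

∪∈° : {U : Family A} {a b : A} →
      (∀ u → U u → u a → u b → a ≡ b) → (U °) (｛ a ｝ ∪ ｛ b ｝)
∪∈° sep u Uu c d uc (inj₁ refl) ud (inj₁ refl) = refl
∪∈° sep u Uu c d uc (inj₁ refl) ud (inj₂ refl) = sep u Uu uc ud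
∪∈° sep u Uu c d uc (inj₂ refl) ud (inj₁ refl) = sym (sep u Uu ud uc)
∪∈° sep u Uu c d uc (inj₂ refl) ud (inj₂ refl) = refl

⊗°-intro : {U : Family A} {V : Family B} {x : Subset (A × B)} →
           (∀ u v → U u → V v → (u ⊠ v) ⊥ x) → ((U ⊗ V) °) x
⊗°-intro orth w (u , v , Uu , Vv , w≐u⊠v) =
  ⊥-antitone (to (w≐u⊠v _)) (λ xa → xa) (orth u v Uu Vv)

⊗°-elim : {U : Family A} {V : Family B} {x : Subset (A × B)} →
          ((U ⊗ V) °) x → ∀ {u v} → U u → V v → (u ⊠ v) ⊥ x
⊗°-elim x∈° {u} {v} Uu Vv = x∈° (u ⊠ v) (u , v , Uu , Vv , λ _ → ⇔.refl)

preimage-⊥ : {f : A → B} → Injective _≡_ _≡_ f →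
             {w y : Subset B} → w ⊥ y → (w ∘ f) ⊥ (y ∘ f)
preimage-⊥ f-inj w⊥y a b wfa yfa wfb yfb = f-inj (w⊥y _ _ wfa yfa wfb yfb)

preimage-⊥-image : {f : A → B} {w : Subset B} {u : Subset A} →
                   (w ∘ f) ⊥ u → w ⊥ ([ u ] λ a b → f a ≡ b)
preimage-⊥-image wf⊥u _ _ wp (a , ua , refl) wq (b , ub , refl) =
  cong _ (wf⊥u a b wp ua wq ub)

preimage-⊥-inverseImage : {f : A → B} → Injective _≡_ _≡_ f →
                          {w y : Subset B} → w ⊥ y → (w ∘ f) ⊥ ((λ a b → f a ≡ b) [ y ])
preimage-⊥-inverseImage f-inj w⊥y a b wfa (_ , ya , refl) wfb (_ , yb , refl) =
  f-inj (w⊥y _ _ wfa ya wfb yb)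

module _ {R S T : Set} (U : Family R) {V Y : Family S} (Z : Family T)
         (cV : IsConcordance V Y) where

  ⊠-⊥-⊠∘assoc : {u : Subset R} {v : Subset (S × T)} {a : Subset (R × S)} {z : Subset T} →
                U u → parU Y Z v → tensorX U V a → Z z →
                (u ⊠ v) ⊥ ((a ⊠ z) ∘ assoc)
  ⊠-⊥-⊠∘assoc {u} {v} {a} {z} Uu v∈° a∈° Zz
              (r , s , t) (r′ , s′ , t′) (ur , vst) (ars , zt) (ur′ , vst′) (ars′ , zt′)
    with ⊗°-elim v∈° (from (proj₂ cV _) (∪∈° s≡s′-inside)) Zz
           (s , t) (s′ , t′) (inj₁ refl , zt) vst (inj₂ refl , zt′) vst′
    where
    s≡s′-inside : ∀ b → V b → b s → b s′ → s ≡ s′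
    s≡s′-inside b Vb bs bs′ =
      cong proj₂ (⊗°-elim a∈° Uu Vb (r , s) (r′ , s′) (ur , bs) ars (ur′ , bs′) ars′)
  ... | refl =
    cong (λ p → proj₁ p , s , t)
      (⊗°-elim a∈° Uu (from (proj₁ cV _) (｛｝∈° Y s))
        (r , s) (r′ , s) (ur , refl) ars (ur′ , refl) ars′)

lemma5p12 : {R S T : Set}
    (U X : Family R) (V Y : Family S) (W Z : Family T) →
    IsConcordance U X → IsConcordance V Y → IsConcordance W Z →
    IsMorphism (tensorU U (parU Y Z)) (tensorX U (parU Y Z))
               (parU (tensorX U V) Z) (parX (tensorX U V) Z)
               assocRel
lemma5p12 U X V Y W Z _ cV _ = image-preserved , inverseImage-preserved
  where
  image-preserved : ∀ u → tensorU U (parU Y Z) u → parU (tensorX U V) Z ([ u ] assocRel)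
  image-preserved u u∈°° = ⊗°-intro λ a z a∈° Zz →
    preimage-⊥-image
      (u∈°° ((a ⊠ z) ∘ assoc) (⊗°-intro λ u′ v Uu′ v∈° → ⊠-⊥-⊠∘assoc U Z cV Uu′ v∈° a∈° Zz))

  -- assoc and assocʳ′ are mutually inverse definitionally (by η for pairs), so
  -- (u ⊠ v) ∘ assocʳ′ ∘ assoc and (a ⊠ z) ∘ assoc ∘ assocʳ′ need no rewriting.
  inverseImage-preserved : ∀ y → parX (tensorX U V) Z y → tensorX U (parU Y Z) (assocRel [ y ])
  inverseImage-preserved y y∈°° = ⊗°-intro λ u v Uu v∈° →
    preimage-⊥-inverseImage (cong assocʳ′)
      (y∈°° ((u ⊠ v) ∘ assocʳ′) (⊗°-intro λ a z a∈° Zz →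
        ⊥-sym (preimage-⊥ (cong assoc) (⊠-⊥-⊠∘assoc U Z cV Uu v∈° a∈° Zz))))
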